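{- Let $G$ be an amenable graph whose anisotropic components in $C(G)$ are $A_1,\dots,A_k$, and for each $i$ let $G_i=G[\bigcup_{X\in A_i}X]$. A labeling $\phi$ of $G$ is distinguishing if and only if, for every $i=1,\dots,k$, the restriction of $\phi$ to $V(G_i)$ is a $\mathcal{P}_G$-distinguishing labeling of $G_i$. Consequently $D(G)=\max\{D(G_i,\mathcal{P}_G): i=1,\dots,k\}$.
   Context: Color refinement on a graph $K$: start with $\mathcal{P}_0=\{V(K)\}$; given $\mathcal{P}_{i-1}$, two vertices lie in the same cell of $\mathcal{P}_i$ iff they lie in the same cell of $\mathcal{P}_{i-1}$ and have the same number of neighbors in every cell of $\mathcal{P}_{i-1}$; stop when stable. The result for $K=G$ is the stable partition $\mathcal{P}_G$. The isomorphism test for $G,H$ runs color refinement on $G\cup H$ and answers "isomorphic" iff each cell of the stable partition of $G\cup H$ has equally many vertices from $G$ and from $H$; $G$ is amenable if this test is correct for every $H$. The cell graph $C(G)$ is the complete graph on the vertex set $\mathcal{P}_G$. For distinct cells $X,Y$, the pair $XY$ is isotropic if the bipartite graph $G[X,Y]$ (vertices $X\cup Y$, edges of $G$ between $X$ and $Y$) is empty or complete bipartite, and anisotropic otherwise. The anisotropic components are the connected components of the graph on $\mathcal{P}_G$ whose edges are the anisotropic pairs. For a partition $\mathcal{P}$ and a graph $F$ with $V(F)$ contained in the ground set, $Aut(F,\mathcal{P})$ is the set of automorphisms of $F$ mapping each vertex into its own cell of $\mathcal{P}$; a labeling of $F$ is $\mathcal{P}$-distinguishing if the only label-preserving element of $Aut(F,\mathcal{P})$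 is the identity, and $D(F,\mathcal{P})$ is the fewest colors of such a labeling. A labeling $\phi$ of $G$ is distinguishing if the only automorphism of $G$ preserving labels is the identity; $D(G)$ is the fewest colors of such a labeling. -}

module Defs where

open import Data.Nat using (ℕ; zero; suc; _+_; _≤_; _⊔_; _≡ᵇ_)
open import Data.Bool using (Bool; true; false; _∧_; _∨_; not; if_then_else_; T)
open import Data.Fin using (Fin; zero; suc; splitAt; _↑ˡ_; _↑ʳ_)
open import Data.Sum using (_⊎_; inj₁; inj₂)
open import Data.Product using (Σ; Σ-syntax; ∃; ∃-syntax; _×_; _,_)
open import Data.Empty using (⊥)
open import Relation.Nullary using (¬_)
open import Relation.Binary.PropositionalEquality using (_≡_)
open import Relation.Binary.Construct.Closure.ReflexiveTransitive using (Star)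
open import Function.Bundles using (_↔_; Inverse)

record Graph : Set where
  field
    n      : ℕ
    adj    : Fin n → Fin n → Bool
    sym    : ∀ u v → adj u v ≡ adj v u
    irrefl : ∀ v → adj v v ≡ false
open Graph public

cnt : ∀ {n} → (Fin n → Bool) → ℕ
cnt {zero}  f = 0
cnt {suc n} f = (if f zero then 1 else 0) + cnt (λ x → f (suc x))

allB : ∀ {n} → (Fin n → Bool) → Bool
allB {zero}  f = true
allB {suc n} f = f zero ∧ allB (λ x → f (suc x))

maxF : ∀ {n} → (Fin n → ℕ) → ℕ
maxF {zero}  f = 0
maxF {suc n} f = f zero ⊔ maxF (λ x → f (suc x))

-- Color refinement on a (raw) graph K with N vertices.
-- A partition is represented by its "same cell" relation P u v : Bool.

Partition : ℕ → Set
Partition N = Fin N → Fin N → Bool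

-- one refinement round: u,v stay together iff they were together and
-- have the same number of neighbours in every cell of the old partition
-- (every cell is the cell of some vertex w).
refine : ∀ {N} → (Fin N → Fin N → Bool) → Partition N → Partition N
refine adjK P u v =
  P u v ∧ allB (λ w → cnt (λ x → adjK u x ∧ P x w) ≡ᵇ cnt (λ x → adjK v x ∧ P x w))

crStep : ∀ {N} → (Fin N → Fin N → Bool) → ℕ → Partition N
crStep adjK zero    = λ _ _ → true
crStep adjK (suc i) = refine adjK (crStep adjK i)

-- the stable partition: on N vertices the refinement stabilises after
-- at most N rounds (each non-final round strictly increases the number
-- of cells), so P_N is the stable partition.
stableCR : ∀ {N} → (Fin N → Fin N → Bool) → Partition N
stableCR {N} adjK = crStep adjK N

PG : (G : Graph) → Partition (n G)
PG G = stableCR (adj G)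

unionAdj : (G H : Graph) → Fin (n G + n H) → Fin (n G + n H) → Bool
unionAdj G H i j with splitAt (n G) i | splitAt (n G) j
... | inj₁ a | inj₁ b = adj G a b
... | inj₂ a | inj₂ b = adj H a b
... | inj₁ _ | inj₂ _ = false
... | inj₂ _ | inj₁ _ = false

-- the test answers "isomorphic": every cell (the cell of each vertex w)
-- of the stable partition of G ∪ H has as many G-vertices as H-vertices
TestSaysIso : (G H : Graph) → Set
TestSaysIso G H =
  ∀ (w : Fin (n G + n H)) →
    cnt (λ x → stableCR (unionAdj G H) (x ↑ˡ n H) w)
      ≡ cnt (λ y → stableCR (unionAdj G H) (n G ↑ʳ y) w)

Isomorphic : (G H : Graph) → Set
Isomorphic G H =
  Σ[ f ∈ Fin (n G) ↔ Fin (n H) ]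
    (∀ u v → adj H (Inverse.to f u) (Inverse.to f v) ≡ adj G u v)

Amenable : Graph → Set
Amenable G = ∀ (H : Graph) → (TestSaysIso G H → Isomorphic G H) × (Isomorphic G H → TestSaysIso G H)

-- for distinct cells X ∋ u and Y ∋ v: G[X,Y] is neither empty nor complete
Anisotropic : (G : Graph) → Fin (n G) → Fin (n G) → Set
Anisotropic G u v =
  ¬ T (PG G u v)
  × (∃[ x ] ∃[ y ] (T (PG G x u) × T (PG G y v) × adj G x y ≡ true))
  × (∃[ x ] ∃[ y ] (T (PG G x u) × T (PG G y v) × adj G x y ≡ false))

-- InComp G r v: the cell of v lies in the anisotropic component of C(G)
-- containing the cell of r (i.e. v ∈ V(G_i) where A_i ∋ cell of r).
InComp : (G : Graph) → Fin (n G) → Fin (n G) → Set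
InComp G = Star (λ a b → T (PG G a b) ⊎ Anisotropic G a b)

record Member {N : ℕ} (S : Fin N → Set) : Set where
  constructor ⟨_,_⟩
  field
    vert : Fin N
    .mem : S vert
open Member public

Distinguishing : (G : Graph) {C : Set} → (Fin (n G) → C) → Set
Distinguishing G φ =
  ∀ (σ : Fin (n G) ↔ Fin (n G)) →
    (∀ u v → adj G (Inverse.to σ u) (Inverse.to σ v) ≡ adj G u v) →
    (∀ v → φ (Inverse.to σ v) ≡ φ v) →
    ∀ v → Inverse.to σ v ≡ v

PDistinguishing : (G : Graph) (S : Fin (n G) → Set) (P : Partition (n G))
                  {C : Set} → (Member S → C) → Set
PDistinguishing G S P ψ =
  ∀ (σ : Member S ↔ Member S) →
    (∀ x y → adj G (vert (Inverse.to σ x)) (vert (Inverse.to σ y)) ≡ adj G (vert x) (vert y)) →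
    (∀ x → T (P (vert (Inverse.to σ x)) (vert x))) →
    (∀ x → ψ (Inverse.to σ x) ≡ ψ x) →
    ∀ x → Inverse.to σ x ≡ x

IsDistNumber : (G : Graph) → ℕ → Set
IsDistNumber G d =
  (Σ[ φ ∈ (Fin (n G) → Fin d) ] Distinguishing G φ)
  × (∀ k (φ : Fin (n G) → Fin k) → Distinguishing G φ → d ≤ k)

IsPDistNumber : (G : Graph) (S : Fin (n G) → Set) (P : Partition (n G)) → ℕ → Set
IsPDistNumber G S P d =
  (Σ[ ψ ∈ (Member S → Fin d) ] PDistinguishing G S P ψ)
  × (∀ k (ψ : Member S → Fin k) → PDistinguishing G S P ψ → d ≤ k)

-- An automorphism of G maps every vertex into its own colour-refinement cell, because the
-- stable partition is computed from adjacency counts alone. Every pair of cells lying in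
-- different anisotropic components is isotropic, so a cell-preserving automorphism of one
-- G_i, extended by the identity, is an automorphism of G; conversely every automorphism of
-- G restricts to each G_i. Thus Aut(G) is the product of the groups Aut(G_i, P_G): a
-- labeling fixes only the identity of Aut(G) iff it does so on every factor, and gluing
-- optimal labelings of the G_i gives D(G) = max D(G_i, P_G).
module Submission where

open import Defs hiding (sym)
open import Data.Nat using (ℕ; zero; suc; _+_; _≤_; _<_; z≤n; s≤s)
open import Data.Nat.Properties
  using (≤-refl; ≤-trans; n≤1+n; <-irrefl; ≡ᵇ⇒≡; ≡⇒≡ᵇ; ⊔-lub; m≤n⇒m≤n⊔o; m≤n⇒m≤o⊔n; +-0-commutativeMonoid)
open import Data.Bool using (Bool; true; false; _∧_; _∨_; if_then_else_; T)
open import Data.Bool.Properties using (T?; T-∧; T-∨; T-≡; ⇔→≡) renaming (_≟_ to _≟ᴮ_)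
open import Data.Fin using (Fin; zero; suc; inject≤)
open import Data.Fin.Properties using (_≟_; any?; inject≤-injective)
open import Data.Maybe using (Maybe; just; nothing)
import Data.Maybe as Maybe
open import Data.Maybe.Properties using (just-injective)
open import Data.Product using (∃; _×_; _,_; proj₁; proj₂)
open import Data.Sum using (_⊎_; inj₁; inj₂)
open import Data.Empty using (⊥-elim; ⊥-elim-irr)
open import Function using (_∘_)
open import Function.Bundles using (_↔_; Inverse; mk↔ₛ′; _⇔_; mk⇔; Equivalence)
import Function.Properties.Equivalence as ⇔
open import Function.Properties.Inverse using (↔-trans; ↔-sym)
open import Relation.Nullary using (¬_; Dec; yes; no)
open import Relation.Nullary.Decidable using (⌊_⌋; map′; recompute; toWitness; fromWitness; _×-dec_; _⊎-dec_; ¬?)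
open import Relation.Binary.Definitions using (Decidable)
open import Relation.Binary.Structures using (IsEquivalence)
open import Relation.Binary.PropositionalEquality
  using (_≡_; refl; sym; trans; cong; cong₂; subst; module ≡-Reasoning)
open import Relation.Binary.Construct.Closure.ReflexiveTransitive using (Star; ε; _◅_; _◅◅_)
import Relation.Binary.Construct.Closure.ReflexiveTransitive as Star
import Algebra.Properties.CommutativeMonoid.Sum as Sum

open Equivalence using (to; from)

T-extensional : ∀ {a b} → T a ⇔ T b → a ≡ b
T-extensional a⇔b = ⇔→≡ (⇔.trans (⇔.sym T-≡) (⇔.trans a⇔b T-≡))

allB⁺ : ∀ {n} (f : Fin n → Bool) → (∀ x → T (f x)) → T (allB f)
allB⁺ {zero}  f all = _
allB⁺ {suc n} f all = from T-∧ (all zero , allB⁺ (f ∘ suc) (all ∘ suc))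

allB⁻ : ∀ {n} (f : Fin n → Bool) → T (allB f) → ∀ x → T (f x)
allB⁻ {suc n} f all zero    = proj₁ (to T-∧ all)
allB⁻ {suc n} f all (suc x) = allB⁻ (f ∘ suc) (proj₂ (to (T-∧ {f zero}) all)) x

cnt-cong : ∀ {n} {f g : Fin n → Bool} → (∀ x → f x ≡ g x) → cnt f ≡ cnt g
cnt-cong {zero}  f≗g = refl
cnt-cong {suc n} f≗g = cong₂ (λ b c → (if b then 1 else 0) + c) (f≗g zero) (cnt-cong (f≗g ∘ suc))

open Sum +-0-commutativeMonoid using (sum; sum-permute)

cnt≡sum : ∀ {n} (f : Fin n → Bool) → cnt f ≡ sum (λ x → if f x then 1 else 0)
cnt≡sum {zero}  f = refl
cnt≡sum {suc n} f = cong ((if f zero then 1 else 0) +_) (cnt≡sum (f ∘ suc))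

cnt-permute : ∀ {n} (f : Fin n → Bool) (σ : Fin n ↔ Fin n) → cnt (f ∘ Inverse.to σ) ≡ cnt f
cnt-permute f σ = begin
  cnt (f ∘ Inverse.to σ)                          ≡⟨ cnt≡sum (f ∘ Inverse.to σ) ⟩
  sum (λ x → if f (Inverse.to σ x) then 1 else 0) ≡⟨ sum-permute (λ x → if f x then 1 else 0) σ ⟨
  sum (λ x → if f x then 1 else 0)                ≡⟨ cnt≡sum f ⟨
  cnt f                                           ∎
  where open ≡-Reasoning

cnt-mono : ∀ {n} {f g : Fin n → Bool} → (∀ x → T (f x) → T (g x)) → cnt f ≤ cnt g
cnt-mono {zero}          f⊆g = z≤n
cnt-mono {suc n} {f} {g} f⊆g with f zero in f₀ | g zero in g₀
... | false | false = cnt-mono (f⊆g ∘ suc)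
... | false | true  = ≤-trans (cnt-mono (f⊆g ∘ suc)) (n≤1+n _)
... | true  | true  = s≤s (cnt-mono (f⊆g ∘ suc))
... | true  | false = ⊥-elim (subst T g₀ (f⊆g zero (subst T (sym f₀) _)))

cnt≤n : ∀ {n} (f : Fin n → Bool) → cnt f ≤ n
cnt≤n {n} f = subst (cnt f ≤_) (cnt-all n) (cnt-mono {f = f} {λ _ → true} (λ _ _ → _))
  where
  cnt-all : ∀ n → cnt {n} (λ _ → true) ≡ n
  cnt-all zero    = refl
  cnt-all (suc n) = cong suc (cnt-all n)

cnt-pos : ∀ {n} (f : Fin n → Bool) x → T (f x) → 0 < cnt f
cnt-pos {suc n} f x fx with f zero in f₀
... | true = s≤s z≤n
cnt-pos {suc n} f zero    fx | false = ⊥-elim (subst T f₀ fx)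
cnt-pos {suc n} f (suc x) fx | false = cnt-pos (f ∘ suc) x fx

cnt-⊆⇒⊇⊎< : ∀ {n} {f g : Fin n → Bool} → (∀ x → T (f x) → T (g x)) →
            (∀ x → T (g x) → T (f x)) ⊎ cnt f < cnt g
cnt-⊆⇒⊇⊎< {zero} f⊆g = inj₁ λ ()
cnt-⊆⇒⊇⊎< {suc n} {f} {g} f⊆g with f zero in f₀ | g zero in g₀ | cnt-⊆⇒⊇⊎< (f⊆g ∘ suc)
... | true  | false | _         = ⊥-elim (subst T g₀ (f⊆g zero (subst T (sym f₀) _)))
... | false | true  | _         = inj₂ (s≤s (cnt-mono (f⊆g ∘ suc)))
... | false | false | inj₂ f<g  = inj₂ f<g
... | true  | true  | inj₂ f<g  = inj₂ (s≤s f<g)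
... | false | false | inj₁ g⊆f = inj₁ λ { zero g0 → ⊥-elim (subst T g₀ g0) ; (suc x) → g⊆f x }
... | true  | true  | inj₁ g⊆f = inj₁ λ { zero _ → subst T (sym f₀) _ ; (suc x) → g⊆f x }

maxF-upper : ∀ {n} (f : Fin n → ℕ) i → f i ≤ maxF f
maxF-upper f zero    = m≤n⇒m≤n⊔o _ ≤-refl
maxF-upper f (suc i) = m≤n⇒m≤o⊔n (f zero) (maxF-upper (f ∘ suc) i)

maxF-least : ∀ {n} (f : Fin n → ℕ) {k} → (∀ i → f i ≤ k) → maxF f ≤ k
maxF-least {zero}  f f≤k = z≤n
maxF-least {suc n} f f≤k = ⊔-lub (f≤k zero) (maxF-least (f ∘ suc) (f≤k ∘ suc))

first : ∀ {n} → (Fin n → Bool) → Maybe (Fin n)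
first {zero}  f = nothing
first {suc n} f = if f zero then just zero else Maybe.map suc (first (f ∘ suc))

first-cong : ∀ {n} {f g : Fin n → Bool} → (∀ x → f x ≡ g x) → first f ≡ first g
first-cong {zero}  f≗g = refl
first-cong {suc n} f≗g =
  cong₂ (λ b m → if b then just zero else Maybe.map suc m) (f≗g zero) (first-cong (f≗g ∘ suc))

first-complete : ∀ {n} (f : Fin n → Bool) x → T (f x) → ∃ λ a → first f ≡ just a × T (f a)
first-complete {suc n} f x fx with f zero in f₀
... | true = zero , refl , subst T (sym f₀) _
first-complete {suc n} f zero    fx | false = ⊥-elim (subst T f₀ fx)
first-complete {suc n} f (suc x) fx | false with first-complete (f ∘ suc) x fx
... | a , first≡a , fa = suc a , cong (Maybe.map suc) first≡a , fa

private module Reachability {N ℓ} {E : Fin N → Fin N → Set ℓ} (E? : Decidable E) (r : Fin N) where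

  reach : ℕ → Fin N → Bool
  step? : ∀ k v → Dec (∃ λ u → T (reach k u) × E u v)

  reach zero    v = ⌊ r ≟ v ⌋
  reach (suc k) v = reach k v ∨ ⌊ step? k v ⌋

  step? k v = any? (λ u → T? (reach k u) ×-dec E? u v)

  reach-sound : ∀ k {v} → T (reach k v) → Star E r v
  reach-sound zero    r≡v = subst (Star E r) (toWitness r≡v) ε
  reach-sound (suc k) h with to T-∨ h
  ... | inj₁ hk   = reach-sound k hk
  ... | inj₂ step with toWitness {a? = step? k _} step
  ...   | u , hu , e = reach-sound k hu ◅◅ (e ◅ ε)

  reach-root : ∀ k → T (reach k r)
  reach-root zero    = fromWitness refl
  reach-root (suc k) = from T-∨ (inj₁ (reach-root k))

  Saturated : ℕ → Set
  Saturated k = ∀ v → T (reach (suc k) v) → T (reach k v)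

  reach-step : ∀ k {u v} → T (reach k u) → E u v → T (reach (suc k) v)
  reach-step k {v = v} hu e = from (T-∨ {reach k v}) (inj₂ (fromWitness {a? = step? k v} (_ , hu , e)))

  saturated-closed : ∀ {k} → Saturated k → ∀ {v w} → T (reach k v) → Star E v w → T (reach k w)
  saturated-closed     sat hv ε        = hv
  saturated-closed {k} sat hv (e ◅ es) = saturated-closed {k} sat (sat _ (reach-step k hv e)) es

  saturated-or-growing : ∀ k → ∃ Saturated ⊎ k < cnt (reach k)
  saturated-or-growing zero = inj₂ (cnt-pos (reach zero) r (reach-root zero))
  saturated-or-growing (suc k) with saturated-or-growing k
  ... | inj₁ sat = inj₁ sat
  ... | inj₂ k<  with cnt-⊆⇒⊇⊎< {f = reach k} (λ v hv → from (T-∨ {reach k v}) (inj₁ hv))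
  ...   | inj₁ sat  = inj₁ (k , sat)
  ...   | inj₂ grow = inj₂ (≤-trans (s≤s k<) grow)

  -- reach k can grow at most N times, since it never has more than N elements
  saturated : ∃ Saturated
  saturated with saturated-or-growing N
  ... | inj₁ sat = sat
  ... | inj₂ N<  = ⊥-elim (<-irrefl refl (≤-trans N< (cnt≤n (reach N))))

  reachable? : ∀ v → Dec (Star E r v)
  reachable? v with saturated
  ... | k , sat = map′ (reach-sound k) (saturated-closed {k} sat (reach-root k)) (T? (reach k v))

Star? : ∀ {N ℓ} {E : Fin N → Fin N → Set ℓ} → Decidable E → Decidable (Star E)
Star? E? r = Reachability.reachable? E? r

SameCell : ∀ {N} → Partition N → Fin N → Fin N → Set
SameCell P u v = T (P u v)

IsAutomorphism : ∀ {N} → (Fin N → Fin N → Bool) → Fin N ↔ Fin N → Set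
IsAutomorphism adjK σ = ∀ u v → adjK (Inverse.to σ u) (Inverse.to σ v) ≡ adjK u v

module ColourRefinement {N} (adjK : Fin N → Fin N → Bool) where

  neighboursInCellOf : Partition N → Fin N → Fin N → ℕ
  neighboursInCellOf P u w = cnt (λ x → adjK u x ∧ P x w)

  refine⁺ : ∀ {P u v} → SameCell P u v → (∀ w → neighboursInCellOf P u w ≡ neighboursInCellOf P v w) →
            SameCell (refine adjK P) u v
  refine⁺ Puv counts = from T-∧ (Puv , allB⁺ _ (λ w → ≡⇒≡ᵇ _ _ (counts w)))

  refine⁻ : ∀ {P u v} → SameCell (refine adjK P) u v →
            SameCell P u v × (∀ w → neighboursInCellOf P u w ≡ neighboursInCellOf P v w)
  refine⁻ {P} {u} h with to (T-∧ {P u _}) h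
  ... | Puv , counts = Puv , λ w → ≡ᵇ⇒≡ _ _ (allB⁻ _ counts w)

  refine-isEquivalence : ∀ {P} → IsEquivalence (SameCell P) → IsEquivalence (SameCell (refine adjK P))
  refine-isEquivalence {P} P-equiv = record
    { refl  = refine⁺ P.refl (λ _ → refl)
    ; sym   = λ uv → refine⁺ (P.sym (proj₁ (refine⁻ uv))) (sym ∘ proj₂ (refine⁻ uv))
    ; trans = λ uv vw → refine⁺ (P.trans (proj₁ (refine⁻ uv)) (proj₁ (refine⁻ vw)))
                                (λ w → trans (proj₂ (refine⁻ uv) w) (proj₂ (refine⁻ vw) w))
    }
    where module P = IsEquivalence P-equiv

  crStep-isEquivalence : ∀ i → IsEquivalence (SameCell (crStep adjK i))
  crStep-isEquivalence zero    = record { refl = _ ; sym = λ _ → _ ; trans = λ _ _ → _ }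
  crStep-isEquivalence (suc i) = refine-isEquivalence (crStep-isEquivalence i)

  module _ (σ : Fin N ↔ Fin N) (σ-aut : IsAutomorphism adjK σ) where
    open Inverse σ using () renaming (to to σ⃗)

    refine-invariant : ∀ {P} → IsEquivalence (SameCell P) → (∀ v → SameCell P (σ⃗ v) v) →
                       ∀ v → SameCell (refine adjK P) (σ⃗ v) v
    refine-invariant {P} P-equiv Pσ v = refine⁺ (Pσ v) λ w → begin
      neighboursInCellOf P (σ⃗ v) w              ≡⟨ cnt-permute _ σ ⟨
      cnt (λ x → adjK (σ⃗ v) (σ⃗ x) ∧ P (σ⃗ x) w) ≡⟨ cnt-cong (λ x → cong₂ _∧_ (σ-aut v x) (σx∼x x w)) ⟩
      neighboursInCellOf P v w                  ∎
      where
      open ≡-Reasoning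
      module P = IsEquivalence P-equiv
      σx∼x : ∀ x w → P (σ⃗ x) w ≡ P x w
      σx∼x x w = T-extensional (mk⇔ (P.trans (P.sym (Pσ x))) (P.trans (Pσ x)))

    crStep-invariant : ∀ i v → SameCell (crStep adjK i) (σ⃗ v) v
    crStep-invariant zero    v = _
    crStep-invariant (suc i) = refine-invariant (crStep-isEquivalence i) (crStep-invariant i)

Member-≡ : ∀ {N} {S : Fin N → Set} {x y : Member S} → vert x ≡ vert y → x ≡ y
Member-≡ refl = refl

Member-cong : ∀ {N} {S S′ : Fin N → Set} → (∀ {v} → S v → S′ v) → (∀ {v} → S′ v → S v) →
              Member S ↔ Member S′
Member-cong S⊆S′ S′⊆S =
  mk↔ₛ′ (λ { ⟨ v , m ⟩ → ⟨ v , S⊆S′ m ⟩ }) (λ { ⟨ v , m ⟩ → ⟨ v , S′⊆S m ⟩ })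
        (λ _ → refl) (λ _ → refl)

module _ {G : Graph} {S : Fin (n G) → Set} {P : Partition (n G)} where

  PDistinguishing-finer : ∀ {C C′} {ψ : Member S → C} {ψ′ : Member S → C′} →
                          (∀ x y → ψ′ x ≡ ψ′ y → ψ x ≡ ψ y) →
                          PDistinguishing G S P ψ → PDistinguishing G S P ψ′
  PDistinguishing-finer finer ψ-dist σ σ-adj σ-cells σ-ψ′ =
    ψ-dist σ σ-adj σ-cells (λ x → finer _ _ (σ-ψ′ x))

  PDistinguishing-cong : ∀ {S′ : Fin (n G) → Set} {C} {ψ : Member S → C} →
                         (S⊆S′ : ∀ {v} → S v → S′ v) (S′⊆S : ∀ {v} → S′ v → S v) →
                         PDistinguishing G S P ψ →
                         PDistinguishing G S′ P (ψ ∘ Inverse.from (Member-cong S⊆S′ S′⊆S))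
  PDistinguishing-cong {S′} S⊆S′ S′⊆S ψ-dist σ σ-adj σ-cells σ-ψ x =
    Member-≡ (cong vert (ψ-dist σ′ (λ _ _ → σ-adj _ _) (λ _ → σ-cells _) (λ _ → σ-ψ _)
                                (Inverse.from S≅S′ x)))
    where
    S≅S′ : Member S ↔ Member S′
    S≅S′ = Member-cong S⊆S′ S′⊆S
    σ′ : Member S ↔ Member S
    σ′ = ↔-trans S≅S′ (↔-trans σ (↔-sym S≅S′))

module ExtendByIdentity {N} {S : Fin N → Set} (S? : ∀ v → Dec (S v)) (σ : Member S ↔ Member S) where

  private
    act : (Member S → Member S) → Fin N → Fin N
    act f v with S? v
    ... | yes m = vert (f ⟨ v , m ⟩)
    ... | no  _ = v

    act-member : ∀ f {v} .(m : S v) → act f v ≡ vert (f ⟨ v , m ⟩)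
    act-member f {v} m with S? v
    ... | yes _ = refl
    ... | no ¬m = ⊥-elim-irr (¬m m)

    act-nonmember : ∀ f {v} → ¬ S v → act f v ≡ v
    act-nonmember f {v} ¬m with S? v
    ... | yes m = ⊥-elim (¬m m)
    ... | no  _ = refl

    act-vert : ∀ f (x : Member S) → act f (vert x) ≡ vert (f x)
    act-vert f ⟨ v , m ⟩ = act-member f m

    act-inverse : ∀ f g → (∀ x → f (g x) ≡ x) → ∀ v → act f (act g v) ≡ v
    act-inverse f g fg v with S? v
    ... | yes m = trans (act-vert f (g ⟨ v , m ⟩)) (cong vert (fg ⟨ v , m ⟩))
    ... | no ¬m = act-nonmember f ¬m

  extend : Fin N ↔ Fin N
  extend = mk↔ₛ′ (act (Inverse.to σ)) (act (Inverse.from σ))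
                 (act-inverse _ _ (Inverse.strictlyInverseˡ σ)) (act-inverse _ _ (Inverse.strictlyInverseʳ σ))

  extend-member : ∀ {v} .(m : S v) → Inverse.to extend v ≡ vert (Inverse.to σ ⟨ v , m ⟩)
  extend-member = act-member (Inverse.to σ)

  extend-nonmember : ∀ {v} → ¬ S v → Inverse.to extend v ≡ v
  extend-nonmember = act-nonmember (Inverse.to σ)

  extend-preserves : ∀ {C : Set} (φ : Fin N → C) → (∀ x → φ (vert (Inverse.to σ x)) ≡ φ (vert x)) →
                     ∀ v → φ (Inverse.to extend v) ≡ φ v
  extend-preserves φ σ-φ v = by-membership (S? v)
    where
    by-membership : Dec (S v) → φ (Inverse.to extend v) ≡ φ v
    by-membership (yes m) = trans (cong φ (extend-member m)) (σ-φ ⟨ v , m ⟩)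
    by-membership (no ¬m) = cong φ (extend-nonmember ¬m)


module _ (G : Graph) where

  private
    N = n G
    P = PG G
    module P = IsEquivalence (ColourRefinement.crStep-isEquivalence (adj G) N)

  automorphism-preserves-cells : ∀ σ → IsAutomorphism (adj G) σ → ∀ v → SameCell P (Inverse.to σ v) v
  automorphism-preserves-cells σ σ-aut = ColourRefinement.crStep-invariant (adj G) σ σ-aut N

  restrictToCells : {S : Fin N → Set} → (∀ {u v} → S u → SameCell P u v → S v) →
                    (σ : Fin N ↔ Fin N) → IsAutomorphism (adj G) σ → Member S ↔ Member S
  restrictToCells S-closed σ σ-aut =
    mk↔ₛ′ (λ { ⟨ v , m ⟩ → ⟨ σ⃗ v , S-closed m (P.sym (cell v)) ⟩ })
          (λ { ⟨ v , m ⟩ → ⟨ σ⃖ v , S-closed m (cell⁻¹ v) ⟩ })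
          (λ x → Member-≡ (strictlyInverseˡ (vert x)))
          (λ x → Member-≡ (strictlyInverseʳ (vert x)))
    where
    open Inverse σ using (strictlyInverseˡ; strictlyInverseʳ) renaming (to to σ⃗; from to σ⃖)
    cell : ∀ v → SameCell P (σ⃗ v) v
    cell = automorphism-preserves-cells σ σ-aut
    cell⁻¹ : ∀ v → SameCell P v (σ⃖ v)
    cell⁻¹ v = subst (λ u → SameCell P u (σ⃖ v)) (strictlyInverseˡ v) (cell (σ⃖ v))

  ComponentStep : Fin N → Fin N → Set
  ComponentStep u v = SameCell P u v ⊎ Anisotropic G u v

  componentStep-sym : ∀ {u v} → ComponentStep u v → ComponentStep v u
  componentStep-sym (inj₁ uv) = inj₁ (P.sym uv)
  componentStep-sym (inj₂ (¬uv , (x , y , xu , yv , xy) , (x′ , y′ , x′u , y′v , ¬x′y′))) =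
    inj₂ (¬uv ∘ P.sym , (y , x , yv , xu , trans (Graph.sym G y x) xy)
                      , (y′ , x′ , y′v , x′u , trans (Graph.sym G y′ x′) ¬x′y′))

  componentStep? : Decidable ComponentStep
  componentStep? u v = T? (P u v) ⊎-dec (¬? (T? (P u v)) ×-dec edgeWith? true ×-dec edgeWith? false)
    where
    edgeWith? : ∀ b → Dec (∃ λ x → ∃ λ y → T (P x u) × T (P y v) × adj G x y ≡ b)
    edgeWith? b = any? λ x → any? λ y → T? (P x u) ×-dec T? (P y v) ×-dec (adj G x y ≟ᴮ b)

  InComp-sym : ∀ {u v} → InComp G u v → InComp G v u
  InComp-sym = Star.reverse componentStep-sym

  InComp? : Decidable (InComp G)
  InComp? = Star? componentStep?

  InComp-closed : ∀ {r u v} → InComp G r u → SameCell P u v → InComp G r v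
  InComp-closed ru uv = ru ◅◅ (inj₁ uv ◅ ε)

  ¬componentStep-leaving : ∀ {r u w} → InComp G r u → ¬ InComp G r w → ¬ ComponentStep u w
  ¬componentStep-leaving ru ¬rw step = ¬rw (ru ◅◅ (step ◅ ε))

  adj-leaving-component : ∀ {r u u′ w} → InComp G r u → SameCell P u′ u → ¬ InComp G r w →
                          adj G u′ w ≡ adj G u w
  adj-leaving-component {r} {u} {u′} {w} ru u′u ¬rw with adj G u′ w in u′w | adj G u w in uw
  ... | true  | true  = refl
  ... | false | false = refl
  ... | true  | false = ⊥-elim (¬step (inj₂ (¬step ∘ inj₁ , (u′ , w , u′u , P.refl , u′w)
                                                          , (u , w , P.refl , P.refl , uw))))
    where ¬step : ¬ ComponentStep u w
          ¬step = ¬componentStep-leaving ru ¬rw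
  ... | false | true  = ⊥-elim (¬step (inj₂ (¬step ∘ inj₁ , (u , w , P.refl , P.refl , uw)
                                                          , (u′ , w , u′u , P.refl , u′w))))
    where ¬step : ¬ ComponentStep u w
          ¬step = ¬componentStep-leaving ru ¬rw

  module _ {r} (σ : Member (InComp G r) ↔ Member (InComp G r))
           (σ-adj : ∀ x y → adj G (vert (Inverse.to σ x)) (vert (Inverse.to σ y)) ≡ adj G (vert x) (vert y))
           (σ-cells : ∀ x → SameCell P (vert (Inverse.to σ x)) (vert x)) where

    open ExtendByIdentity (InComp? r) σ

    extend-isAutomorphism : IsAutomorphism (adj G) extend
    extend-isAutomorphism u v = by-membership (InComp? r u) (InComp? r v)
      where
      by-membership : Dec (InComp G r u) → Dec (InComp G r v) →
                      adj G (Inverse.to extend u) (Inverse.to extend v) ≡ adj G u v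
      by-membership (yes ru) (yes rv) =
        trans (cong₂ (adj G) (extend-member ru) (extend-member rv)) (σ-adj ⟨ u , ru ⟩ ⟨ v , rv ⟩)
      by-membership (yes ru) (no ¬rv) =
        trans (cong₂ (adj G) (extend-member ru) (extend-nonmember ¬rv))
              (adj-leaving-component ru (σ-cells ⟨ u , ru ⟩) ¬rv)
      by-membership (no ¬ru) (yes rv) =
        trans (cong₂ (adj G) (extend-nonmember ¬ru) (extend-member rv))
              (trans (Graph.sym G u _)
                     (trans (adj-leaving-component rv (σ-cells ⟨ v , rv ⟩) ¬ru) (Graph.sym G v u)))
      by-membership (no ¬ru) (no ¬rv) = cong₂ (adj G) (extend-nonmember ¬ru) (extend-nonmember ¬rv)

  components-of-distinguishing : ∀ {C} (φ : Fin N → C) → Distinguishing G φ →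
                                 ∀ r → PDistinguishing G (InComp G r) P (φ ∘ vert)
  components-of-distinguishing φ φ-dist r σ σ-adj σ-cells σ-φ ⟨ v , m ⟩ = Member-≡ (begin
    vert (Inverse.to σ ⟨ v , m ⟩) ≡⟨ extend-member m ⟨
    Inverse.to extend v          ≡⟨ φ-dist extend (extend-isAutomorphism σ σ-adj σ-cells)
                                          (extend-preserves φ σ-φ) v ⟩
    v                            ∎)
    where
    open ≡-Reasoning
    open ExtendByIdentity (InComp? r) σ

  distinguishing-from-components : ∀ {C} (φ : Fin N → C) →
                                   (∀ r → PDistinguishing G (InComp G r) P (φ ∘ vert)) → Distinguishing G φ
  distinguishing-from-components φ φ-dist σ σ-aut σ-φ v =
    cong vert (φ-dist v (restrictToCells InComp-closed σ σ-aut)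
                        (λ x y → σ-aut (vert x) (vert y))
                        (λ x → automorphism-preserves-cells σ σ-aut (vert x))
                        (λ x → σ-φ (vert x))
                        ⟨ v , ε ⟩)

  private
    inComponentOf : Fin N → Fin N → Bool
    inComponentOf v a = ⌊ InComp? a v ⌋

    representative-spec : ∀ v → ∃ λ a → first (inComponentOf v) ≡ just a × T (inComponentOf v a)
    representative-spec v = first-complete (inComponentOf v) v (fromWitness ε)

  -- a canonical vertex of each component, so that a whole component is labelled by one optimal labeling
  representative : Fin N → Fin N
  representative v = proj₁ (representative-spec v)

  representative-InComp : ∀ v → InComp G (representative v) v
  representative-InComp v = toWitness (proj₂ (proj₂ (representative-spec v)))

  representative-cong : ∀ {r v} → InComp G r v → representative v ≡ representative r
  representative-cong {r} {v} rv = just-injective (begin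
    just (representative v) ≡⟨ proj₁ (proj₂ (representative-spec v)) ⟨
    first (inComponentOf v) ≡⟨ first-cong (λ a → T-extensional (mk⇔ (along (InComp-sym rv)) (along rv))) ⟩
    first (inComponentOf r) ≡⟨ proj₁ (proj₂ (representative-spec r)) ⟩
    just (representative r) ∎)
    where
    open ≡-Reasoning
    along : ∀ {a u w} → InComp G u w → T (inComponentOf u a) → T (inComponentOf w a)
    along {a} {u} uw au = fromWitness (toWitness {a? = InComp? a u} au ◅◅ uw)

  module _ (d : Fin N → ℕ) (d-optimal : ∀ r → IsPDistNumber G (InComp G r) P (d r)) where

    private
      ψ : ∀ r → Member (InComp G r) → Fin (d r)
      ψ r = proj₁ (proj₁ (d-optimal r))

      labelVia : (a v : Fin N) → .(InComp G a v) → Fin (maxF d)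
      labelVia a v m = inject≤ (ψ a ⟨ v , m ⟩) (maxF-upper d a)

      labelVia-cong : ∀ {a a′} v .(m : InComp G a v) .(m′ : InComp G a′ v) → a ≡ a′ →
                      labelVia a v m ≡ labelVia a′ v m′
      labelVia-cong v m m′ refl = refl

    combinedLabeling : Fin N → Fin (maxF d)
    combinedLabeling v = labelVia (representative v) v (representative-InComp v)

    combinedLabeling-PDistinguishing : ∀ r → PDistinguishing G (InComp G r) P (combinedLabeling ∘ vert)
    combinedLabeling-PDistinguishing r =
      PDistinguishing-finer {G = G} {P = P} (λ { ⟨ v , m ⟩ ⟨ w , m′ ⟩ → finer m m′ })
        (PDistinguishing-cong {G = G} {P = P} (InComp-sym r̂r ◅◅_) (r̂r ◅◅_)
                              (proj₂ (proj₁ (d-optimal r̂))))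
      where
      r̂ : Fin N
      r̂ = representative r
      r̂r : InComp G r̂ r
      r̂r = representative-InComp r

      onComponent : ∀ {v} .(m : InComp G r v) → combinedLabeling v ≡ labelVia r̂ v (r̂r ◅◅ m)
      onComponent {v} m = labelVia-cong v _ _ (representative-cong (recompute (InComp? r v) m))

      finer : ∀ {v w} .(m : InComp G r v) .(m′ : InComp G r w) → combinedLabeling v ≡ combinedLabeling w →
              ψ r̂ ⟨ v , r̂r ◅◅ m ⟩ ≡ ψ r̂ ⟨ w , r̂r ◅◅ m′ ⟩
      finer m m′ eq =
        inject≤-injective _ _ _ _ (trans (sym (onComponent m)) (trans eq (onComponent m′)))

    distinguishingNumber-max : IsDistNumber G (maxF d)
    distinguishingNumber-max =
        (combinedLabeling , distinguishing-from-components combinedLabeling combinedLabeling-PDistinguishing)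
      , λ k φ φ-dist → maxF-least d λ r →
          proj₂ (d-optimal r) k (φ ∘ vert) (components-of-distinguishing φ φ-dist r)

theorem6 : (G : Graph) → Amenable G →
    ((C : Set) (φ : Fin (n G) → C) →
        Distinguishing G φ
          ⇔ (∀ (r : Fin (n G)) → PDistinguishing G (InComp G r) (PG G) (λ x → φ (vert x))))
    × ((d : Fin (n G) → ℕ) → (∀ r → IsPDistNumber G (InComp G r) (PG G) (d r)) →
        IsDistNumber G (maxF d))
theorem6 G _ =
    (λ C φ → mk⇔ (components-of-distinguishing G φ) (distinguishing-from-components G φ))
  , distinguishingNumber-max G
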